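{- Let $G$ be a diamond-free graph. Let $C'=\{v_1,\dots,v_\ell\}$ be a clique in $G$ and let $C_1,\dots,C_\ell$ be maximal cliques of $G$ such that for every $i\in\{1,\dots,\ell\}$ we have $C_i\cap C'=\{v_i\}$, $2\le \ell=|C'|\le |C_i|$, and $C_i\cap C_j=\emptyset$ for all $j\neq i$. Then there exists a stable set $S\subseteq \bigcup_{i=1}^\ell C_i$ in $G-C'$ with $|S|=\ell-1$ and $|N_G(S)\cap C'|=|S|$. Furthermore, if $\max_{1\le i\le \ell}|C_i|>\ell$, then there exists a stable set $S\subseteq\bigcup_{i=1}^\ell C_i$ in $G-C'$ with $|S|=\ell$ such that every vertex of $C'$ has a neighbor in $S$.
   Context: Graphs are finite and simple. The diamond is $K_4$ minus an edge; diamond-free means no induced diamond. For $X\subseteq V(G)$, $N_G(X)$ denotes the set of vertices in $V(G)\setminus X$ having a neighbor in $X$. $G-C'$ is the graph obtained by deleting the vertices of $C'$. -}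

module Defs where

open import Data.Nat using (ℕ)
open import Data.Fin using (Fin)
open import Data.Fin.Subset using (Subset; _∈_; _∉_; ⋃; ⁅_⁆; _∩_; ∣_∣)
open import Data.Fin.Properties using (any?)
open import Data.Product using (∃; _×_; _,_)
open import Data.List using (List; tabulate)
open import Data.Vec using (tabulate)
open import Relation.Binary.PropositionalEquality using (_≡_; _≢_)
open import Relation.Nullary using (¬_; Dec; does)
open import Relation.Nullary.Decidable using (_×-dec_; ¬?)
open import Data.Fin.Subset.Properties using (_∈?_)

record Graph (n : ℕ) : Set₁ where
  field
    Adj    : Fin n → Fin n → Set
    adj?   : ∀ x y → Dec (Adj x y)
    sym    : ∀ {x y} → Adj x y → Adj y x
    irrefl : ∀ {x} → ¬ Adj x x
open Graph public

module _ {n : ℕ} (G : Graph n) where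

  DiamondFree : Set
  DiamondFree = ∀ (a b c d : Fin n) →
    a ≢ b → a ≢ c → a ≢ d → b ≢ c → b ≢ d → c ≢ d →
    Adj G a b → Adj G a c → Adj G a d → Adj G b c → Adj G b d →
    Adj G c d

  IsClique : Subset n → Set
  IsClique K = ∀ {x y} → x ∈ K → y ∈ K → x ≢ y → Adj G x y

  IsMaximalClique : Subset n → Set
  IsMaximalClique K = IsClique K ×
    (∀ z → z ∉ K → ¬ (∀ {x} → x ∈ K → Adj G z x))

  IsStable : Subset n → Set
  IsStable S = ∀ {x y} → x ∈ S → y ∈ S → ¬ Adj G x y

  N : Subset n → Subset n
  N X = Data.Vec.tabulate λ y →
    does (¬? (y ∈? X) ×-dec any? (λ x → (x ∈? X) ×-dec adj? G y x))

⋃ᶠ : ∀ {n ℓ} → (Fin ℓ → Subset n) → Subset n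
⋃ᶠ C = ⋃ (Data.List.tabulate C)

-- Write v_i for the vertex of C_i on C′ and call the other vertices of C_i outer.
-- Diamond-freeness together with the maximality of the C_i gives two local facts:
-- an outer vertex of C_i is adjacent to no v_j with j ≠ i, and it has at most one
-- neighbour among the outer vertices of C_j. Hence, when outer vertices of k
-- other cliques have been chosen, at most k + 1 vertices of C_i are excluded
-- (v_i and one neighbour of each chosen vertex), and a clique with more than
-- k + 1 vertices still offers a choice. Choosing greedily in ℓ − 1 of the
-- cliques (and finally in the large one) yields the stable sets; the
-- neighbours of S on C′ are exactly the v_i of the cliques used.
module Submission where

open import Defs hiding (sym)
open import Data.Nat using (ℕ; zero; suc; _+_; _≤_; _<_; z≤n; s≤s)
open import Data.Nat.Properties
  using (≤-trans; ≤-reflexive; ≤-<-trans; <-trans; n<1+n; n≤1+n; <⇒≱; +-suc; +-mono-≤; +-monoʳ-≤)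
open import Data.Fin using (Fin; zero; suc; punchIn; punchOut; _≟_)
open import Data.Fin.Properties
  using (any?; 0≢1+n; suc-injective; punchIn-injective; punchInᵢ≢i; punchIn-punchOut)
open import Data.Fin.Subset using (Subset; _∈_; _∉_; _⊆_; ⁅_⁆; _∩_; _∪_; ∣_∣; ⊥; inside; outside)
open import Data.Fin.Subset.Properties
  using (_∈?_; nonempty?; Empty-unique; x∈⁅x⁆; x∈⁅y⁆⇒x≡y; ∣⁅x⁆∣≡1; ⊆-antisym; ⊥⊆; ∉⊥; ∣⊥∣≡0;
         p⊆q⇒∣p∣≤∣q∣; x∈p∩q⁺; x∈p∩q⁻; x∈p∪q⁺; x∈p∪q⁻)
open import Data.Product using (Σ; ∃; _×_; _,_; proj₁; proj₂)
open import Data.Sum using (inj₁; inj₂)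
open import Data.Empty using (⊥-elim)
open import Data.Vec using ([]; _∷_; here; there; tabulate)
open import Data.Vec.Properties using ([]=⇒lookup; lookup⇒[]=; lookup∘tabulate)
open import Data.Vec.Functional using (head; tail) renaming (_∷_ to _∷ᶠ_)
open import Function using (_∘_)
open import Function.Definitions using (Injective; StrictlySurjective)
open import Relation.Nullary using (¬_; Dec; yes; no; does)
open import Relation.Nullary.Decidable using (_×-dec_; ¬?; dec-true)
open import Relation.Binary.PropositionalEquality
  using (_≡_; _≢_; refl; sym; trans; cong; cong₂; subst)

module _ {n} {P : Fin n → Set} (P? : ∀ x → Dec (P x)) where

  ∈-tabulate-does⁺ : ∀ {x} → P x → x ∈ tabulate (does ∘ P?)
  ∈-tabulate-does⁺ {x} px =
    lookup⇒[]= x _ (trans (lookup∘tabulate (does ∘ P?) x) (dec-true (P? x) px))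

  ∈-tabulate-does⁻ : ∀ {x} → x ∈ tabulate (does ∘ P?) → P x
  ∈-tabulate-does⁻ {x} x∈ with P? x | trans (sym (lookup∘tabulate (does ∘ P?) x)) ([]=⇒lookup x∈)
  ... | yes px | _ = px
  ... | no _   | ()

∣p∪q∣≤∣p∣+∣q∣ : ∀ {n} (p q : Subset n) → ∣ p ∪ q ∣ ≤ ∣ p ∣ + ∣ q ∣
∣p∪q∣≤∣p∣+∣q∣ []            []            = z≤n
∣p∪q∣≤∣p∣+∣q∣ (outside ∷ p) (outside ∷ q) = ∣p∪q∣≤∣p∣+∣q∣ p q
∣p∪q∣≤∣p∣+∣q∣ (outside ∷ p) (inside  ∷ q) =
  ≤-trans (s≤s (∣p∪q∣≤∣p∣+∣q∣ p q)) (≤-reflexive (sym (+-suc ∣ p ∣ ∣ q ∣)))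
∣p∪q∣≤∣p∣+∣q∣ (inside  ∷ p) (outside ∷ q) = s≤s (∣p∪q∣≤∣p∣+∣q∣ p q)
∣p∪q∣≤∣p∣+∣q∣ (inside  ∷ p) (inside  ∷ q) =
  s≤s (≤-trans (∣p∪q∣≤∣p∣+∣q∣ p q) (+-monoʳ-≤ ∣ p ∣ (n≤1+n ∣ q ∣)))

∣p∪q∣≡∣p∣+∣q∣ : ∀ {n} (p q : Subset n) → (∀ {x} → x ∈ p → x ∉ q) → ∣ p ∪ q ∣ ≡ ∣ p ∣ + ∣ q ∣
∣p∪q∣≡∣p∣+∣q∣ []            []            _    = refl
∣p∪q∣≡∣p∣+∣q∣ (inside  ∷ p) (inside  ∷ q) disj = ⊥-elim (disj here here)
∣p∪q∣≡∣p∣+∣q∣ (inside  ∷ p) (outside ∷ q) disj =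
  cong suc (∣p∪q∣≡∣p∣+∣q∣ p q (λ x∈p → disj (there x∈p) ∘ there))
∣p∪q∣≡∣p∣+∣q∣ (outside ∷ p) (inside  ∷ q) disj =
  trans (cong suc (∣p∪q∣≡∣p∣+∣q∣ p q (λ x∈p → disj (there x∈p) ∘ there))) (sym (+-suc ∣ p ∣ ∣ q ∣))
∣p∪q∣≡∣p∣+∣q∣ (outside ∷ p) (outside ∷ q) disj =
  ∣p∪q∣≡∣p∣+∣q∣ p q (λ x∈p → disj (there x∈p) ∘ there)

∣q∣<∣p∣⇒∃∈p∉q : ∀ {n} (p q : Subset n) → ∣ q ∣ < ∣ p ∣ → ∃ λ x → x ∈ p × x ∉ q
∣q∣<∣p∣⇒∃∈p∉q p q ∣q∣<∣p∣ with any? (λ x → (x ∈? p) ×-dec ¬? (x ∈? q))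
... | yes witness = witness
... | no none     = ⊥-elim (<⇒≱ ∣q∣<∣p∣ (p⊆q⇒∣p∣≤∣q∣ p⊆q))
  where
  p⊆q : p ⊆ q
  p⊆q {x} x∈p with x ∈? q
  ... | yes x∈q = x∈q
  ... | no  x∉q = ⊥-elim (none (x , x∈p , x∉q))

∣p∣≤1 : ∀ {n} (p : Subset n) → (∀ {x y} → x ∈ p → y ∈ p → x ≡ y) → ∣ p ∣ ≤ 1
∣p∣≤1 {n} p unique with nonempty? p
... | yes (x , x∈p) = ≤-trans (p⊆q⇒∣p∣≤∣q∣ p⊆⁅x⁆) (≤-reflexive (∣⁅x⁆∣≡1 x))
  where
  p⊆⁅x⁆ : p ⊆ ⁅ x ⁆
  p⊆⁅x⁆ y∈p = subst (_∈ ⁅ x ⁆) (unique x∈p y∈p) (x∈⁅x⁆ x)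
... | no empty rewrite Empty-unique empty | ∣⊥∣≡0 n = z≤n

x∈⋃ᶠ⁺ : ∀ {n k} (B : Fin k → Subset n) j {x} → x ∈ B j → x ∈ ⋃ᶠ B
x∈⋃ᶠ⁺ B zero    x∈B = x∈p∪q⁺ (inj₁ x∈B)
x∈⋃ᶠ⁺ B (suc j) x∈B = x∈p∪q⁺ (inj₂ (x∈⋃ᶠ⁺ (tail B) j x∈B))

x∈⋃ᶠ⁻ : ∀ {n k} (B : Fin k → Subset n) {x} → x ∈ ⋃ᶠ B → ∃ λ j → x ∈ B j
x∈⋃ᶠ⁻ {k = zero}  B x∈ = ⊥-elim (∉⊥ x∈)
x∈⋃ᶠ⁻ {k = suc k} B x∈ with x∈p∪q⁻ (head B) (⋃ᶠ (tail B)) x∈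
... | inj₁ x∈B₀ = zero , x∈B₀
... | inj₂ x∈⋃  with x∈⋃ᶠ⁻ (tail B) x∈⋃
...   | j , x∈B = suc j , x∈B

∣⋃ᶠ∣≤ : ∀ {n k} (B : Fin k → Subset n) → (∀ j → ∣ B j ∣ ≤ 1) → ∣ ⋃ᶠ B ∣ ≤ k
∣⋃ᶠ∣≤ {n} {zero}  B _   = ≤-reflexive (∣⊥∣≡0 n)
∣⋃ᶠ∣≤ {n} {suc k} B ≤1 = ≤-trans (∣p∪q∣≤∣p∣+∣q∣ (head B) (⋃ᶠ (tail B)))
  (+-mono-≤ (≤1 zero) (∣⋃ᶠ∣≤ (tail B) (≤1 ∘ suc)))

image : ∀ {n k} → (Fin k → Fin n) → Subset n
image f = ⋃ᶠ (λ j → ⁅ f j ⁆)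

f∈image : ∀ {n k} (f : Fin k → Fin n) j → f j ∈ image f
f∈image f j = x∈⋃ᶠ⁺ (λ j → ⁅ f j ⁆) j (x∈⁅x⁆ (f j))

∈image⁻ : ∀ {n k} (f : Fin k → Fin n) {x} → x ∈ image f → ∃ λ j → x ≡ f j
∈image⁻ f x∈ with x∈⋃ᶠ⁻ (λ j → ⁅ f j ⁆) x∈
... | j , x∈⁅fj⁆ = j , x∈⁅y⁆⇒x≡y (f j) x∈⁅fj⁆

∣image∣≡ : ∀ {n k} (f : Fin k → Fin n) → Injective _≡_ _≡_ f → ∣ image f ∣ ≡ k
∣image∣≡ {n} {zero}  f _     = ∣⊥∣≡0 n
∣image∣≡ {n} {suc k} f f-inj = trans
  (∣p∪q∣≡∣p∣+∣q∣ ⁅ head f ⁆ (image (tail f)) head∉image-tail)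
  (cong₂ _+_ (∣⁅x⁆∣≡1 (head f)) (∣image∣≡ (tail f) (suc-injective ∘ f-inj)))
  where
  head∉image-tail : ∀ {x} → x ∈ ⁅ head f ⁆ → x ∉ image (tail f)
  head∉image-tail x∈⁅f₀⁆ x∈ with ∈image⁻ (tail f) x∈
  ... | j , x≡fsj with f-inj (trans (sym (x∈⁅y⁆⇒x≡y (head f) x∈⁅f₀⁆)) x≡fsj)
  ...   | ()

∷-punchIn-injective : ∀ {k} (i : Fin (suc k)) → Injective _≡_ _≡_ (i ∷ᶠ punchIn i)
∷-punchIn-injective i {zero}  {zero}  _ = refl
∷-punchIn-injective i {zero}  {suc j} e = ⊥-elim (punchInᵢ≢i i j (sym e))
∷-punchIn-injective i {suc j} {zero}  e = ⊥-elim (punchInᵢ≢i i j e)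
∷-punchIn-injective i {suc j} {suc j′} e = cong suc (punchIn-injective i j j′ e)

∷-punchIn-surjective : ∀ {k} (i : Fin (suc k)) → StrictlySurjective _≡_ (i ∷ᶠ punchIn i)
∷-punchIn-surjective i j with i ≟ j
... | yes i≡j = zero , i≡j
... | no  i≢j = suc (punchOut i≢j) , punchIn-punchOut i≢j


module _ {n} (G : Graph n) where

  IsStableFamily : ∀ {k} → (Fin k → Fin n) → Set
  IsStableFamily x = ∀ j j′ → ¬ Adj G (x j) (x j′)

  stableFamily-∷ : ∀ {k} {x : Fin k → Fin n} {y} → IsStableFamily x →
    (∀ j → ¬ Adj G y (x j)) → IsStableFamily (y ∷ᶠ x)
  stableFamily-∷ x-stable y≁x zero    zero     = irrefl G
  stableFamily-∷ x-stable y≁x zero    (suc j′) = y≁x j′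
  stableFamily-∷ x-stable y≁x (suc j) zero     = y≁x j ∘ Graph.sym G
  stableFamily-∷ x-stable y≁x (suc j) (suc j′) = x-stable j j′

  image-stable : ∀ {k} {x : Fin k → Fin n} → IsStableFamily x → IsStable G (image x)
  image-stable {x = x} x-stable y∈ z∈ with ∈image⁻ x y∈ | ∈image⁻ x z∈
  ... | j , refl | j′ , refl = x-stable j j′


module Configuration {n} (G : Graph n) (diamond-free : DiamondFree G)
  {ℓ} (v : Fin ℓ → Fin n) (C′ : Subset n) (C : Fin ℓ → Subset n)
  (C′≡image : C′ ≡ image v) (C′-clique : IsClique G C′)
  (C-maximal : ∀ i → IsMaximalClique G (C i))
  (C∩C′≡⁅v⁆ : ∀ i → C i ∩ C′ ≡ ⁅ v i ⁆)
  (C-disjoint : ∀ i j → i ≢ j → C i ∩ C j ≡ ⊥) where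

  private
    adj-sym : ∀ {x y} → Adj G x y → Adj G y x
    adj-sym = Graph.sym G

  C-clique : ∀ i → IsClique G (C i)
  C-clique i = proj₁ (C-maximal i)

  v∈C : ∀ i → v i ∈ C i
  v∈C i = proj₁ (x∈p∩q⁻ (C i) C′ (subst (v i ∈_) (sym (C∩C′≡⁅v⁆ i)) (x∈⁅x⁆ (v i))))

  v∈C′ : ∀ i → v i ∈ C′
  v∈C′ i = subst (v i ∈_) (sym C′≡image) (f∈image v i)

  ∈C′⇒≡v : ∀ {x} → x ∈ C′ → ∃ λ i → x ≡ v i
  ∈C′⇒≡v x∈C′ = ∈image⁻ v (subst (_ ∈_) C′≡image x∈C′)

  ∈C-unique : ∀ {x i j} → x ∈ C i → x ∈ C j → i ≡ j
  ∈C-unique {x} {i} {j} x∈Ci x∈Cj with i ≟ j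
  ... | yes i≡j = i≡j
  ... | no  i≢j = ⊥-elim (∉⊥ (subst (x ∈_) (C-disjoint i j i≢j) (x∈p∩q⁺ (x∈Ci , x∈Cj))))

  ∈C-distinct : ∀ {x y i j} → x ∈ C i → y ∈ C j → i ≢ j → x ≢ y
  ∈C-distinct x∈Ci y∈Cj i≢j refl = i≢j (∈C-unique x∈Ci y∈Cj)

  v-injective : Injective _≡_ _≡_ v
  v-injective {i} {j} vi≡vj = ∈C-unique (v∈C i) (subst (_∈ C j) (sym vi≡vj) (v∈C j))

  Outer : Fin ℓ → Fin n → Set
  Outer i x = x ∈ C i × x ≢ v i

  outer-∉C′ : ∀ {i x} → Outer i x → x ∉ C′
  outer-∉C′ {i} {x} (x∈C , x≢v) x∈C′ =
    x≢v (x∈⁅y⁆⇒x≡y (v i) (subst (x ∈_) (C∩C′≡⁅v⁆ i) (x∈p∩q⁺ (x∈C , x∈C′))))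

  outer-≢v : ∀ {i x} → Outer i x → ∀ j → x ≢ v j
  outer-≢v x-outer j refl = outer-∉C′ x-outer (v∈C′ j)

  -- If x ~ v_j, then v_j would extend the maximal clique C_i: for any other z ∈ C_i
  -- the diamond x, v_i, z, v_j forces z ~ v_j.
  outer-≁v : ∀ {i j x} → Outer i x → i ≢ j → ¬ Adj G x (v j)
  outer-≁v {i} {j} {x} x-outer@(x∈C , x≢vi) i≢j x~vj =
    proj₂ (C-maximal i) (v j) vj∉Ci vj~Ci
    where
    vj∉Ci : v j ∉ C i
    vj∉Ci vj∈Ci = i≢j (∈C-unique vj∈Ci (v∈C j))
    vi≢vj : v i ≢ v j
    vi≢vj = i≢j ∘ v-injective
    vj~Ci : ∀ {z} → z ∈ C i → Adj G (v j) z
    vj~Ci {z} z∈C with z ≟ x | z ≟ v i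
    ... | yes refl | _        = adj-sym x~vj
    ... | no  _    | yes refl = C′-clique (v∈C′ j) (v∈C′ i) (vi≢vj ∘ sym)
    ... | no  z≢x  | no  z≢vi = adj-sym
      (diamond-free x (v i) z (v j) x≢vi (z≢x ∘ sym) (outer-≢v x-outer j)
        (z≢vi ∘ sym) vi≢vj (∈C-distinct z∈C (v∈C j) i≢j)
        (C-clique i x∈C (v∈C i) x≢vi) (C-clique i x∈C z∈C (z≢x ∘ sym)) x~vj
        (C-clique i (v∈C i) z∈C (z≢vi ∘ sym)) (C′-clique (v∈C′ i) (v∈C′ j) vi≢vj))

  -- Two outer neighbours y, y′ of x in C_j would make y, y′, x, v_j a diamond.
  outer-outerNeighbour-unique : ∀ {i j x y y′} → Outer i x → i ≢ j →
    Outer j y → Outer j y′ → Adj G x y → Adj G x y′ → y ≡ y′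
  outer-outerNeighbour-unique {i} {j} {x} {y} {y′}
    x-outer@(x∈C , _) i≢j (y∈C , y≢v) (y′∈C , y′≢v) x~y x~y′ with y ≟ y′
  ... | yes y≡y′ = y≡y′
  ... | no  y≢y′ = ⊥-elim (outer-≁v x-outer i≢j
      (diamond-free y y′ x (v j) y≢y′ (∈C-distinct x∈C y∈C i≢j ∘ sym) y≢v
        (∈C-distinct x∈C y′∈C i≢j ∘ sym) y′≢v (outer-≢v x-outer j)
        (C-clique j y∈C y′∈C y≢y′) (adj-sym x~y) (C-clique j y∈C (v∈C j) y≢v)
        (adj-sym x~y′) (C-clique j y′∈C (v∈C j) y′≢v)))

  neighboursIn : Fin ℓ → Fin n → Subset n
  neighboursIn i w = tabulate (λ y → does ((y ∈? C i) ×-dec adj? G y w))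

  ∣neighboursIn∣≤1 : ∀ {i j w} → Outer j w → j ≢ i → ∣ neighboursIn i w ∣ ≤ 1
  ∣neighboursIn∣≤1 {i} {j} {w} w-outer j≢i = ∣p∣≤1 (neighboursIn i w) λ y∈ y′∈ →
    outer-outerNeighbour-unique w-outer j≢i (outer y∈) (outer y′∈)
      (adj-sym (proj₂ (member y∈))) (adj-sym (proj₂ (member y′∈)))
    where
    member : ∀ {y} → y ∈ neighboursIn i w → y ∈ C i × Adj G y w
    member = ∈-tabulate-does⁻ (λ y → (y ∈? C i) ×-dec adj? G y w)
    outer : ∀ {y} → y ∈ neighboursIn i w → Outer i y
    outer y∈ = proj₁ (member y∈) , λ { refl → outer-≁v w-outer j≢i (adj-sym (proj₂ (member y∈))) }

  record StableTransversal {k} (σ : Fin k → Fin ℓ) : Set where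
    field
      pick   : Fin k → Fin n
      outer  : ∀ j → Outer (σ j) (pick j)
      stable : IsStableFamily G pick

  open StableTransversal

  extend : ∀ {k} {σ : Fin (suc k) → Fin ℓ} → Injective _≡_ _≡_ σ →
    suc k < ∣ C (head σ) ∣ → StableTransversal (tail σ) → StableTransversal σ
  extend {k} {σ} σ-inj big T
    with ∣q∣<∣p∣⇒∃∈p∉q (C i) excluded (≤-<-trans ∣excluded∣≤ big)
    where
    i : Fin ℓ
    i = head σ
    excluded : Subset n
    excluded = ⁅ v i ⁆ ∪ ⋃ᶠ (neighboursIn i ∘ pick T)
    ∣excluded∣≤ : ∣ excluded ∣ ≤ suc k
    ∣excluded∣≤ = ≤-trans (∣p∪q∣≤∣p∣+∣q∣ ⁅ v i ⁆ (⋃ᶠ (neighboursIn i ∘ pick T)))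
      (+-mono-≤ (≤-reflexive (∣⁅x⁆∣≡1 (v i)))
        (∣⋃ᶠ∣≤ _ λ j → ∣neighboursIn∣≤1 (outer T j) (0≢1+n ∘ σ-inj ∘ sym)))
  ... | y , y∈C , y∉excluded = record
    { pick   = y ∷ᶠ pick T
    ; outer  = λ { zero → y∈C , y≢v ; (suc j) → outer T j }
    ; stable = stableFamily-∷ G (stable T) y≁picks
    }
    where
    y≢v : y ≢ v (head σ)
    y≢v refl = y∉excluded (x∈p∪q⁺ (inj₁ (x∈⁅x⁆ y)))
    y≁picks : ∀ j → ¬ Adj G y (pick T j)
    y≁picks j y~ = y∉excluded (x∈p∪q⁺ (inj₂ (x∈⋃ᶠ⁺ (neighboursIn (head σ) ∘ pick T) j
      (∈-tabulate-does⁺ (λ y′ → (y′ ∈? C (head σ)) ×-dec adj? G y′ (pick T j)) (y∈C , y~)))))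

  greedy : ∀ {k} (σ : Fin k → Fin ℓ) → Injective _≡_ _≡_ σ →
    (∀ j → k < ∣ C (σ j) ∣) → StableTransversal σ
  greedy {zero}  σ _     _   = record { pick = λ () ; outer = λ () ; stable = λ () }
  greedy {suc k} σ σ-inj big = extend σ-inj (big zero)
    (greedy (tail σ) (suc-injective ∘ σ-inj) (λ j → <-trans (n<1+n k) (big (suc j))))

  module _ {k} {σ : Fin k → Fin ℓ} (σ-inj : Injective _≡_ _≡_ σ) (T : StableTransversal σ) where

    private
      S : Subset n
      S = image (pick T)

    pick-injective : Injective _≡_ _≡_ (pick T)
    pick-injective {j} {j′} e = σ-inj (∈C-unique (proj₁ (outer T j))
      (subst (_∈ C (σ j′)) (sym e) (proj₁ (outer T j′))))

    image-pick⊆⋃C : S ⊆ ⋃ᶠ C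
    image-pick⊆⋃C x∈S with ∈image⁻ (pick T) x∈S
    ... | j , refl = x∈⋃ᶠ⁺ C (σ j) (proj₁ (outer T j))

    ∈image-pick⇒∉C′ : ∀ {x} → x ∈ S → x ∉ C′
    ∈image-pick⇒∉C′ x∈S with ∈image⁻ (pick T) x∈S
    ... | j , refl = outer-∉C′ (outer T j)

    image-pick∩C′≡⊥ : S ∩ C′ ≡ ⊥
    image-pick∩C′≡⊥ = ⊆-antisym (λ x∈ → let (x∈S , x∈C′) = x∈p∩q⁻ S C′ x∈ in
      ⊥-elim (∈image-pick⇒∉C′ x∈S x∈C′)) ⊥⊆

    ∣image-pick∣≡ : ∣ S ∣ ≡ k
    ∣image-pick∣≡ = ∣image∣≡ (pick T) pick-injective

    v~pick : ∀ j → Adj G (v (σ j)) (pick T j)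
    v~pick j = C-clique (σ j) (v∈C (σ j)) (proj₁ (outer T j)) (proj₂ (outer T j) ∘ sym)

    N-image-pick∩C′≡ : N G S ∩ C′ ≡ image (v ∘ σ)
    N-image-pick∩C′≡ = ⊆-antisym ⊆image ⊇image
      where
      inN : ∀ y → Dec (y ∉ S × ∃ λ w → w ∈ S × Adj G y w)
      inN y = ¬? (y ∈? S) ×-dec any? (λ w → (w ∈? S) ×-dec adj? G y w)
      ⊆image : N G S ∩ C′ ⊆ image (v ∘ σ)
      ⊆image {z} z∈ with x∈p∩q⁻ (N G S) C′ z∈
      ... | z∈N , z∈C′ with ∈-tabulate-does⁻ inN z∈N | ∈C′⇒≡v z∈C′
      ... | _ , w , w∈S , z~w | i , refl with ∈image⁻ (pick T) w∈S
      ... | j , refl with σ j ≟ i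
      ... | yes refl = f∈image (v ∘ σ) j
      ... | no  σj≢i = ⊥-elim (outer-≁v (outer T j) σj≢i (adj-sym z~w))
      ⊇image : image (v ∘ σ) ⊆ N G S ∩ C′
      ⊇image z∈ with ∈image⁻ (v ∘ σ) z∈
      ... | j , refl = x∈p∩q⁺
        ( ∈-tabulate-does⁺ inN
            ((λ v∈S → ∈image-pick⇒∉C′ v∈S (v∈C′ (σ j))) , pick T j , f∈image (pick T) j , v~pick j)
        , v∈C′ (σ j))

    ∣N-image-pick∩C′∣≡ : ∣ N G S ∩ C′ ∣ ≡ k
    ∣N-image-pick∩C′∣≡ = trans (cong ∣_∣ N-image-pick∩C′≡) (∣image∣≡ (v ∘ σ) (σ-inj ∘ v-injective))

    image-pick-dominates-C′ : StrictlySurjective _≡_ σ →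
      ∀ {x} → x ∈ C′ → ∃ λ y → y ∈ S × Adj G x y
    image-pick-dominates-C′ σ-surj x∈C′ with ∈C′⇒≡v x∈C′
    ... | i , refl with σ-surj i
    ... | j , refl = pick T j , f∈image (pick T) j , v~pick j

lemma7 : ∀ {n} (G : Graph n) → DiamondFree G →
    ∀ (ℓ : ℕ) (v : Fin ℓ → Fin n) (C′ : Subset n) (C : Fin ℓ → Subset n) →
    C′ ≡ ⋃ᶠ (λ i → ⁅ v i ⁆) →
    IsClique G C′ →
    2 ≤ ℓ → ∣ C′ ∣ ≡ ℓ →
    (∀ i → IsMaximalClique G (C i)) →
    (∀ i → C i ∩ C′ ≡ ⁅ v i ⁆) →
    (∀ i → ℓ ≤ ∣ C i ∣) →
    (∀ i j → i ≢ j → C i ∩ C j ≡ ⊥) →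
    (Σ (Subset n) λ S → S ⊆ ⋃ᶠ C × S ∩ C′ ≡ ⊥ × IsStable G S ×
        ∣ S ∣ ≡ ℓ Data.Nat.∸ 1 × ∣ N G S ∩ C′ ∣ ≡ ∣ S ∣)
    ×
    ((∃ λ i → ℓ < ∣ C i ∣) →
      Σ (Subset n) λ S → S ⊆ ⋃ᶠ C × S ∩ C′ ≡ ⊥ × IsStable G S ×
        ∣ S ∣ ≡ ℓ × (∀ {x} → x ∈ C′ → ∃ λ y → y ∈ S × Adj G x y))
lemma7 G diamond-free (suc t) v C′ C C′≡image C′-clique _ _ C-maximal C∩C′≡⁅v⁆ C-big C-disjoint =
  ( image (pick T) , image-pick⊆⋃C suc-injective T , image-pick∩C′≡⊥ suc-injective T
  , image-stable G (stable T) , ∣image-pick∣≡ suc-injective T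
  , trans (∣N-image-pick∩C′∣≡ suc-injective T) (sym (∣image-pick∣≡ suc-injective T)) )
  , λ (m , C-bigger) → let T′ = extendAt m C-bigger in
    ( image (pick T′) , image-pick⊆⋃C (σ-inj m) T′ , image-pick∩C′≡⊥ (σ-inj m) T′
    , image-stable G (stable T′) , ∣image-pick∣≡ (σ-inj m) T′
    , image-pick-dominates-C′ (σ-inj m) T′ (∷-punchIn-surjective m) )
  where
  open Configuration G diamond-free v C′ C C′≡image C′-clique C-maximal C∩C′≡⁅v⁆ C-disjoint
  open StableTransversal

  T : StableTransversal suc
  T = greedy suc suc-injective (C-big ∘ suc)

  σ-inj : ∀ m → Injective _≡_ _≡_ (m ∷ᶠ punchIn m)
  σ-inj = ∷-punchIn-injective

  extendAt : ∀ m → suc t < ∣ C m ∣ → StableTransversal (m ∷ᶠ punchIn m)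
  extendAt m C-bigger =
    extend (σ-inj m) C-bigger (greedy (punchIn m) (punchIn-injective m _ _) (C-big ∘ punchIn m))
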